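{- If $N$ is a $\beta$-normal form and $\mathtt{Infer}(N)=(\Gamma,\varphi)$, then the $\mathcal{C}$-type $T^N=\langle\Gamma\rangle\Rightarrow\varphi$ is complete.
   Context: Terms (de Bruijn): $M,N::=\underline{n}\mid (M\,N)\mid\lambda.M$, $n\in\mathbb{N}^*$; application associates to the left. A $\beta$-normal form is a term with no subterm $((\lambda.M)\,N)$; these are exactly $\underline{n}$, $\lambda.N'$ with $N'$ a $\beta$-normal form, and $\underline{n}\,N_1\cdots N_m$ with each $N_j$ a $\beta$-normal form. Types: $\mathcal{A}$ a denumerable set of type variables; $\tau\in\mathcal{T}::=\alpha\mid u\to\tau$, $u\in\mathcal{U}::=\omega\mid u\wedge u\mid\tau$, $\wedge$ commutative, associative, neutral element $\omega$; $\to$ right-associative. Contexts $\Gamma::=nil\mid u.\Gamma$; $\omega^{k}.\Gamma$ is $\Gamma$ prefixed by $k$ copies of $\omega$, $\omega^k$ alone is $\omega^k.nil$; $nil\wedge\Gamma=\Gamma\wedge nil=\Gamma$, $(u_1.\Gamma)\wedge(u_2.\Delta)=(u_1\wedge u_2).(\Gamma\wedge\Delta)$. Subsets: $\rho\in\mathcal{T}_C::=\alpha\mid\varphi\to\rho$; $\varphi\in\mathcal{T}_{NF}::=\alpha\mid v\to\varphi$; $v\in\mathcal{U}_C::=\omega\mid v\wedge v\mid\rho$; $\mathcal{C}$: contexts with elements in $\mathcal{U}_C$. $\mathtt{Infer}$: $\mathtt{Infer}(\underline{n})=(\omega^{n-1}.\alpha.nil,\alpha)$, $\alpha$ fresh;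 $\mathtt{Infer}(\lambda.N')$: let $(\Gamma',\sigma)=\mathtt{Infer}(N')$; if $\Gamma'=u.\Gamma$ return $(\Gamma,u\to\sigma)$, else return $(nil,\omega\to\sigma)$; $\mathtt{Infer}(\underline{n}\,N_1\cdots N_m)$ ($m\ge1$): let $(\Gamma^i,\sigma_i)=\mathtt{Infer}(N_i)$, $\alpha$ fresh; return $((\omega^{n-1}.(\sigma_1\to\cdots\to\sigma_m\to\alpha).nil)\wedge\Gamma^1\wedge\cdots\wedge\Gamma^m,\alpha)$. Fresh variables are never reused, so distinct calls yield disjoint type variables. A $\mathcal{C}$-type is $\langle\Gamma\rangle\Rightarrow\varphi$ ($\Gamma\in\mathcal{C}$, $\varphi\in\mathcal{T}_{NF}$) or $\langle\Delta\rangle\Rightarrow$ ($\Delta\in\mathcal{C}$, $|\Delta|>0$). Polarity: $\alpha$ positive in $\alpha$; in $u\to\tau$ occurrences in $\tau$ keep sign, in $u$ reversed; $\wedge$ and context elements keep signs; in $\langle\Gamma\rangle\Rightarrow\varphi$ occurrences in $\varphi$ keep sign, in $\Gamma$ reversed. Closed: every type variable of $T$ has exactly one positive and one negative occurrence in $T$. Final occurrence: of $\alpha$ is $\alpha$, of $u\to\tau$ that of $\tau$; final occurrences of $\tau_1\wedge\cdots\wedge\tau_k$ are those of the $\tau_j$. $L(\langle\Gamma\rangle\Rightarrow)=L(\Gamma)$, $L(\langle\Gamma\rangle\Rightarrow\varphi)=L(\Gamma)\cup L(\varphi)$, $L(v.\Gamma)=\{v\}\cup L(\Gamma)$ if $v\ne\omega$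 else $L(\Gamma)$, $L(nil)=\emptyset$, $L(v\to\varphi)=\{v\}\cup L(\varphi)$ if $v\neq\omega$ else $L(\varphi)$, $L(\alpha)=\emptyset$. Finally closed: the final occurrence of $\varphi$ is also the final occurrence of a type in $L(T)$. Held: for $T=\langle\Gamma\rangle\Rightarrow\varphi$, $T'$ is held in $T$ if $T'=\langle\Gamma'\rangle\Rightarrow$ or $\langle\Gamma'\rangle\Rightarrow\varphi$ with $\Gamma=\Gamma'\wedge\Delta$ for some context $\Delta$ and $\Gamma'$ not of the form $\omega^k$, $k\ge1$ ($\Gamma'=nil$ allowed in the second form); strictly held if $T'\ne T$. Minimally closed: no closed $\mathcal{C}$-type strictly held in $T$. Complete: closed, finally closed and minimally closed. -}

module Defs where

open import Data.Nat using (ℕ; zero; suc; _<_)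
open import Data.Bool using (Bool; true; false; not)
open import Data.List using (List; []; _∷_; [_]; _++_; replicate; foldl; map; length)
open import Data.List.Relation.Unary.All using (All)
open import Data.List.Relation.Binary.Pointwise using (Pointwise)
open import Data.List.Relation.Binary.Permutation.Propositional using (_↭_)
open import Data.List.Membership.Propositional using (_∈_)
open import Data.Maybe using (Maybe; just; nothing)
open import Data.Product using (_×_; _,_; Σ; ∃; ∃-syntax; proj₁; proj₂)
open import Data.Empty using (⊥)
open import Relation.Nullary using (¬_; yes; no)
open import Relation.Binary.PropositionalEquality using (_≡_; _≢_)
import Data.Nat as ℕ
import Data.Bool as B

-- Terms (de Bruijn).  CONVENTION: `var k` denotes the index  k+1  (the
-- paper's indices range over ℕ* = {1,2,...}).

data Term : Set where
  var : ℕ → Term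
  app : Term → Term → Term
  lam : Term → Term

data _⊑_ : Term → Term → Set where
  here  : ∀ {M} → M ⊑ M
  inAppˡ : ∀ {P M N} → P ⊑ M → P ⊑ app M N
  inAppʳ : ∀ {P M N} → P ⊑ N → P ⊑ app M N
  inLam  : ∀ {P M} → P ⊑ M → P ⊑ lam M

BetaNormal : Term → Set
BetaNormal T = ∀ M N → ¬ (app (lam M) N ⊑ T)

-- Types.  ∧ is commutative, associative with neutral ω, so an element of
-- 𝒰 is represented as a finite list (multiset) of types:
--   ω = [],  u ∧ v = u ++ v,  τ (as element of 𝒰) = [ τ ].

data Ty : Set where
  tv  : ℕ → Ty
  _⇒_ : List Ty → Ty → Ty

infixr 5 _⇒_

U : Set
U = List Ty

Ctx : Set
Ctx = List U

ωs : ℕ → Ctx → Ctx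
ωs k Γ = replicate k [] ++ Γ

_∧C_ : Ctx → Ctx → Ctx
[] ∧C Δ = Δ
(u ∷ Γ) ∧C [] = u ∷ Γ
(u ∷ Γ) ∧C (v ∷ Δ) = (u ++ v) ∷ (Γ ∧C Δ)

arrows : List Ty → Ty → Ty
arrows [] τ = τ
arrows (σ ∷ σs) τ = [ σ ] ⇒ arrows σs τ

-- Fresh variables are drawn from a counter that is
-- threaded through the computation (so they are never reused).
-- On terms that are not β-normal the result is irrelevant (junk).

mutual
  -- infer M s = (Γ , σ , s')  where s is the next fresh variable before
  -- and s' after the call
  infer : Term → ℕ → Ctx × Ty × ℕ
  infer (var k) s = ωs k ([ tv s ] ∷ []) , tv s , suc s
  infer (lam M) s with infer M s
  ... | (u ∷ Γ) , σ , s' = Γ , u ⇒ σ , s'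
  ... | [] , σ , s' = [] , [] ⇒ σ , s'
  infer (app M N) s = finishApp (spine (app M N) s)

  spine : Term → ℕ → Maybe (ℕ × List (Ctx × Ty)) × ℕ
  spine (var k) s = just (k , []) , s
  spine (lam M) s = nothing , s
  spine (app M N) s with spine M s
  ... | nothing , s₁ = nothing , s₁
  ... | just (k , args) , s₁ with infer N s₁
  ...   | Γ , σ , s₂ = just (k , args ++ [ (Γ , σ) ]) , s₂

  finishApp : Maybe (ℕ × List (Ctx × Ty)) × ℕ → Ctx × Ty × ℕ
  finishApp (just (k , args) , s) =
    foldl _∧C_ (ωs k ([ arrows (map proj₂ args) (tv s) ] ∷ [])) (map proj₁ args)
    , tv s , suc s
  finishApp (nothing , s) = [] , tv s , suc s

mutual
  data IsTC : Ty → Set where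
    tc-var : ∀ α → IsTC (tv α)
    tc-arr : ∀ {φ ρ} → IsTNF φ → IsTC ρ → IsTC ([ φ ] ⇒ ρ)

  data IsTNF : Ty → Set where
    tnf-var : ∀ α → IsTNF (tv α)
    tnf-arr : ∀ {v φ} → All IsTC v → IsTNF φ → IsTNF (v ⇒ φ)

IsUC : U → Set
IsUC v = All IsTC v

IsCtxC : Ctx → Set
IsCtxC Γ = All IsUC Γ

-- 𝒞-types:  ⟨ Γ ⟩⇒ φ   and   ⟨ Δ ⟩⇒∅  (the latter written ⟨Δ⟩⇒ in the paper)

data CTy : Set where
  ⟨_⟩⇒_ : Ctx → Ty → CTy
  ⟨_⟩⇒∅ : Ctx → CTy

IsCType : CTy → Set
IsCType (⟨ Γ ⟩⇒ φ) = IsCtxC Γ × IsTNF φ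
IsCType (⟨ Δ ⟩⇒∅) = IsCtxC Δ × 0 < length Δ

-- Polarity: list of occurrences (sign , variable); true = positive

mutual
  occT : Bool → Ty → List (Bool × ℕ)
  occT b (tv α) = [ (b , α) ]
  occT b (u ⇒ τ) = occU (not b) u ++ occT b τ

  occU : Bool → U → List (Bool × ℕ)
  occU b [] = []
  occU b (τ ∷ u) = occT b τ ++ occU b u

occC : Bool → Ctx → List (Bool × ℕ)
occC b [] = []
occC b (u ∷ Γ) = occU b u ++ occC b Γ

occCT : CTy → List (Bool × ℕ)
occCT (⟨ Γ ⟩⇒ φ) = occC false Γ ++ occT true φ
occCT (⟨ Δ ⟩⇒∅) = occC false Δ

countOcc : Bool → ℕ → List (Bool × ℕ) → ℕ
countOcc b α [] = 0
countOcc b α ((b' , β) ∷ xs) with b B.≟ b' | α ℕ.≟ β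
... | yes _ | yes _ = suc (countOcc b α xs)
... | _     | _     = countOcc b α xs

Closed : CTy → Set
Closed T = ∀ α → α ∈ map proj₂ (occCT T) →
           (countOcc true α (occCT T) ≡ 1) × (countOcc false α (occCT T) ≡ 1)

final : Ty → ℕ
final (tv α) = α
final (u ⇒ τ) = final τ

addU : U → List U → List U
addU [] L = L
addU (τ ∷ v) L = (τ ∷ v) ∷ L

LTy : Ty → List U
LTy (tv α) = []
LTy (v ⇒ φ) = addU v (LTy φ)

LCtx : Ctx → List U
LCtx [] = []
LCtx (v ∷ Γ) = addU v (LCtx Γ)

LCT : CTy → List U
LCT (⟨ Γ ⟩⇒ φ) = LCtx Γ ++ LTy φ
LCT (⟨ Δ ⟩⇒∅) = LCtx Δ

-- finally closed (for ⟨Γ⟩⇒φ): the final occurrence of φ (i.e. its final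
-- variable) is also the final occurrence of a type in L(T); the final
-- occurrences of u = τ₁ ∧ ⋯ ∧ τₖ are those of the τⱼ
FinallyClosed : Ctx → Ty → Set
FinallyClosed Γ φ = ∃[ u ] (u ∈ LCT (⟨ Γ ⟩⇒ φ) × ∃[ τ ] (τ ∈ u × final τ ≡ final φ))

-- equality of contexts modulo commutativity/associativity of ∧ (slotwise)
_≈C_ : Ctx → Ctx → Set
Γ ≈C Δ = Pointwise _↭_ Γ Δ

NotOmegaPow : Ctx → Set
NotOmegaPow Γ = ∀ k → Γ ≢ replicate (suc k) []

HeldIn : CTy → Ctx → Ty → Set
HeldIn (⟨ Γ' ⟩⇒ φ') Γ φ = φ' ≡ φ × NotOmegaPow Γ' × ∃[ Δ ] ((Γ' ∧C Δ) ≈C Γ)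
HeldIn (⟨ Γ' ⟩⇒∅) Γ φ = NotOmegaPow Γ' × ∃[ Δ ] ((Γ' ∧C Δ) ≈C Γ)

SameAs : CTy → Ctx → Ty → Set
SameAs (⟨ Γ' ⟩⇒ φ') Γ φ = Γ' ≈C Γ × φ' ≡ φ
SameAs (⟨ Γ' ⟩⇒∅) Γ φ = ⊥

StrictlyHeldIn : CTy → Ctx → Ty → Set
StrictlyHeldIn T' Γ φ = HeldIn T' Γ φ × ¬ SameAs T' Γ φ

MinimallyClosed : Ctx → Ty → Set
MinimallyClosed Γ φ = ∀ T' → IsCType T' → StrictlyHeldIn T' Γ φ → ¬ Closed T'

Complete : Ctx → Ty → Set
Complete Γ φ = Closed (⟨ Γ ⟩⇒ φ) × FinallyClosed Γ φ × MinimallyClosed Γ φ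

module Submission where

-- Infer draws a fresh variable α for each occurrence of a head variable and uses it exactly
-- twice: positively as the result type and negatively at the end of the type
-- σ₁ → ⋯ → σₘ → α it assigns to the head.  Hence, if the call consumes the variables
-- [s, s'), each of them occurs once with each sign in ⟨Γ⟩⇒φ and nothing else occurs:
-- T^N is closed.  For minimal closedness, a held type amounts to a sub-multiset X of the
-- types in Γ; it is closed only if its occurrences (with those of φ, if it keeps φ) are
-- balanced.  The arguments of a head use disjoint intervals of variables, so a balanced
-- selection restricts to a balanced selection for each argument, and the fresh α forces
-- the head type into any selection balanced with φ = α and out of any selection balanced
-- on its own.  By induction, a selection balanced with φ is everything and one balanced
-- alone is empty; a λ only moves a context entry into φ and preserves all of this.  Final
-- closedness holds because the final variable of φ is that of a head type in Γ.

open import Defs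
open import Data.Nat using (ℕ)
open import Data.Product using (_×_; _,_)

open import Algebra.Bundles using (CommutativeMonoid)
import Algebra.Properties.CommutativeSemigroup as CommutativeSemigroupProperties
open import Data.Bool as Bool using (Bool; true; false)
open import Data.Empty using (⊥; ⊥-elim)
open import Data.List using (List; []; _∷_; [_]; _++_; concat; concatMap; foldl; length; map; replicate)
import Data.List.Properties as List
open import Data.List.Membership.Propositional using (_∈_; _∉_)
open import Data.List.Membership.Propositional.Properties
  using (∈-++⁺ˡ; ∈-++⁻; ∈-∃++; ∈-concat⁻′)
open import Data.List.Relation.Binary.Permutation.Propositional as ↭
  using (_↭_; ↭-refl; ↭-sym; ↭-trans; ↭-reflexive; prep; module PermutationReasoning)
open import Data.List.Relation.Binary.Permutation.Propositional.Properties
  using (++⁺ˡ; ++⁺ʳ; ++⁺; ++-assoc; ++-identityʳ; ++-commutativeMonoid; shift; shifts; drop-∷;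
         ∈-resp-↭; ↭-empty-inv; ↭-singleton-inv)
open import Data.List.Relation.Binary.Pointwise using ([]; _∷_)
open import Data.List.Relation.Unary.All as All using (All; []; _∷_)
import Data.List.Relation.Unary.All.Properties as All
open import Data.List.Relation.Unary.Any using (here; there)
open import Data.Maybe using (Maybe; just; nothing)
open import Data.Nat as ℕ using (zero; suc; _≤_; _<_; _+_)
import Data.Nat.Properties as ℕ
open import Data.List.Membership.DecPropositional ℕ._≟_ using (_∈?_)
open import Data.Product using (∃-syntax; proj₁; proj₂)
open import Data.Sum as Sum using (_⊎_; inj₁; inj₂)
open import Data.Unit using (⊤; tt)
open import Function using (_∘_)
open import Relation.Binary.PropositionalEquality
  using (_≡_; _≢_; refl; sym; trans; cong; cong₂; subst; subst₂; module ≡-Reasoning)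
open import Relation.Nullary using (¬_; yes; no)

module ↭-Algebra {A : Set} =
  CommutativeSemigroupProperties (CommutativeMonoid.commutativeSemigroup (++-commutativeMonoid {A = A}))
module +-Algebra = CommutativeSemigroupProperties ℕ.+-commutativeSemigroup

record Refinement {A : Set} (X Y P Q : List A) : Set where
  field
    X₁ X₂ Y₁ Y₂ : List A
    X↭ : X ↭ X₁ ++ X₂
    Y↭ : Y ↭ Y₁ ++ Y₂
    ↭P : X₁ ++ Y₁ ↭ P
    ↭Q : X₂ ++ Y₂ ↭ Q

↭-refine : ∀ {A : Set} (P : List A) {Q X Y} → X ++ Y ↭ P ++ Q → Refinement X Y P Q
↭-refine [] {X = X} {Y} XY↭Q = record
  { X₁ = [] ; X₂ = X ; Y₁ = [] ; Y₂ = Y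
  ; X↭ = ↭-refl ; Y↭ = ↭-refl ; ↭P = ↭-refl ; ↭Q = XY↭Q
  }
↭-refine (p ∷ P) {X = X} {Y} XY↭ with ∈-++⁻ X (∈-resp-↭ (↭-sym XY↭) (here refl))
... | inj₁ p∈X with xs , xs' , refl ← ∈-∃++ p∈X =
  let open Refinement (↭-refine P {X = xs ++ xs'} (drop-∷ (↭-trans (↭-sym pull) XY↭))) in record
    { X₁ = p ∷ X₁ ; X₂ = X₂ ; Y₁ = Y₁ ; Y₂ = Y₂
    ; X↭ = ↭-trans (shift p xs xs') (prep p X↭) ; Y↭ = Y↭ ; ↭P = prep p ↭P ; ↭Q = ↭Q
    }
  where
  pull : (xs ++ p ∷ xs') ++ Y ↭ p ∷ (xs ++ xs') ++ Y
  pull = begin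
    (xs ++ p ∷ xs') ++ Y  ↭⟨ ++-assoc xs (p ∷ xs') Y ⟩
    xs ++ p ∷ xs' ++ Y    ↭⟨ shift p xs (xs' ++ Y) ⟩
    p ∷ xs ++ xs' ++ Y    ↭⟨ prep p (++-assoc xs xs' Y) ⟨
    p ∷ (xs ++ xs') ++ Y  ∎
    where open PermutationReasoning
... | inj₂ p∈Y with ys , ys' , refl ← ∈-∃++ p∈Y =
  let open Refinement (↭-refine P {X = X} (drop-∷ (↭-trans (↭-sym pull) XY↭))) in record
    { X₁ = X₁ ; X₂ = X₂ ; Y₁ = p ∷ Y₁ ; Y₂ = Y₂
    ; X↭ = X↭ ; Y↭ = ↭-trans (shift p ys ys') (prep p Y↭)
    ; ↭P = ↭-trans (shift p X₁ Y₁) (prep p ↭P) ; ↭Q = ↭Q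
    }
  where
  pull : X ++ ys ++ p ∷ ys' ↭ p ∷ X ++ ys ++ ys'
  pull = ↭-trans (++⁺ˡ X (shift p ys ys')) (shift p X (ys ++ ys'))

↭-∷-split : ∀ {A : Set} {a : A} {F X Y} → X ++ Y ↭ a ∷ F →
            (∃[ X' ] (X ↭ a ∷ X' × X' ++ Y ↭ F)) ⊎ (∃[ Y' ] (Y ↭ a ∷ Y' × X ++ Y' ↭ F))
↭-∷-split {a = a} {F} {X} {Y} XY↭ = choose X₁ Y₁ (↭-singleton-inv ↭P) X↭ Y↭
  where
  open Refinement (↭-refine [ a ] {X = X} XY↭)
  choose : ∀ X₁ Y₁ → X₁ ++ Y₁ ≡ [ a ] → X ↭ X₁ ++ X₂ → Y ↭ Y₁ ++ Y₂ →
           (∃[ X' ] (X ↭ a ∷ X' × X' ++ Y ↭ F)) ⊎ (∃[ Y' ] (Y ↭ a ∷ Y' × X ++ Y' ↭ F))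
  choose []       _  refl X↭X₂  Y↭aY₂ = inj₂ (Y₂ , Y↭aY₂ , ↭-trans (++⁺ʳ Y₂ X↭X₂) ↭Q)
  choose (_ ∷ []) [] refl X↭aX₂ Y↭Y₂  = inj₁ (X₂ , X↭aX₂ , ↭-trans (++⁺ˡ X₂ Y↭Y₂) ↭Q)

Occurrences : Set
Occurrences = List (Bool × ℕ)

module _ (b : Bool) (α : ℕ) where

  countOcc-++ : ∀ (o o' : Occurrences) → countOcc b α (o ++ o') ≡ countOcc b α o + countOcc b α o'
  countOcc-++ []             o' = refl
  countOcc-++ ((b' , β) ∷ o) o' with b Bool.≟ b' | α ℕ.≟ β
  ... | yes _ | yes _ = cong suc (countOcc-++ o o')
  ... | yes _ | no _  = countOcc-++ o o'
  ... | no _  | _     = countOcc-++ o o'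

  countOcc-∷ : ∀ x (o : Occurrences) → countOcc b α (x ∷ o) ≡ countOcc b α [ x ] + countOcc b α o
  countOcc-∷ x = countOcc-++ [ x ]

  countOcc-↭ : ∀ {o o' : Occurrences} → o ↭ o' → countOcc b α o ≡ countOcc b α o'
  countOcc-↭ ↭.refl = refl
  countOcc-↭ (↭.prep {xs} {ys} x p) = begin
    # (x ∷ xs)      ≡⟨ countOcc-∷ x xs ⟩
    # [ x ] + # xs  ≡⟨ cong (# [ x ] +_) (countOcc-↭ p) ⟩
    # [ x ] + # ys  ≡⟨ countOcc-∷ x ys ⟨
    # (x ∷ ys)      ∎
    where
    open ≡-Reasoning
    # : Occurrences → ℕ
    # = countOcc b α
  countOcc-↭ (↭.swap {xs} {ys} x y p) = begin
    # (x ∷ y ∷ xs)              ≡⟨ count-∷∷ x y xs ⟩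
    # [ x ] + (# [ y ] + # xs)  ≡⟨ +-Algebra.x∙yz≈y∙xz (# [ x ]) (# [ y ]) (# xs) ⟩
    # [ y ] + (# [ x ] + # xs)  ≡⟨ cong (λ n → # [ y ] + (# [ x ] + n)) (countOcc-↭ p) ⟩
    # [ y ] + (# [ x ] + # ys)  ≡⟨ count-∷∷ y x ys ⟨
    # (y ∷ x ∷ ys)              ∎
    where
    open ≡-Reasoning
    # : Occurrences → ℕ
    # = countOcc b α
    count-∷∷ : ∀ x y o → # (x ∷ y ∷ o) ≡ # [ x ] + (# [ y ] + # o)
    count-∷∷ x y o = trans (countOcc-∷ x (y ∷ o)) (cong (# [ x ] +_) (countOcc-∷ y o))
  countOcc-↭ (↭.trans p q) = trans (countOcc-↭ p) (countOcc-↭ q)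

countOcc-self : ∀ b α → countOcc b α [ (b , α) ] ≡ 1
countOcc-self b α with b Bool.≟ b | α ℕ.≟ α
... | yes _  | yes _   = refl
... | yes _  | no α≢α  = ⊥-elim (α≢α refl)
... | no b≢b | _       = ⊥-elim (b≢b refl)

countOcc-other : ∀ b α b' β → (b , α) ≢ (b' , β) → countOcc b α [ (b' , β) ] ≡ 0
countOcc-other b α b' β x≢y with b Bool.≟ b' | α ℕ.≟ β
... | yes refl | yes refl = ⊥-elim (x≢y refl)
... | yes _    | no _     = refl
... | no _     | _        = refl

countOcc-∉ : ∀ b α (o : Occurrences) → α ∉ map proj₂ o → countOcc b α o ≡ 0
countOcc-∉ b α []             _  = refl
countOcc-∉ b α ((b' , β) ∷ o) α∉ = trans (countOcc-∷ b α (b' , β) o)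
  (cong₂ _+_ (countOcc-other b α b' β (α∉ ∘ here ∘ cong proj₂)) (countOcc-∉ b α o (α∉ ∘ there)))

countOcc-∈ : ∀ α (o : Occurrences) → α ∈ map proj₂ o → ∃[ b ] countOcc b α o ≢ 0
countOcc-∈ α ((b , .α) ∷ o) (here refl) = b , λ count≡0 → ℕ.1+n≢0 (trans (sym count≡1+) count≡0)
  where
  count≡1+ : countOcc b α ((b , α) ∷ o) ≡ suc (countOcc b α o)
  count≡1+ = trans (countOcc-∷ b α (b , α) o) (cong (_+ countOcc b α o) (countOcc-self b α))
countOcc-∈ α (x ∷ o) (there α∈o) with countOcc-∈ α o α∈o
... | b , count≢0 = b , λ count≡0 →
  count≢0 (ℕ.m+n≡0⇒n≡0 (countOcc b α [ x ]) (trans (sym (countOcc-∷ b α x o)) count≡0))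

record Balanced (o : Occurrences) : Set where
  constructor balanced
  field balanced-at : ∀ α → countOcc true α o ≡ countOcc false α o

open Balanced

balanced-resp-↭ : ∀ {o o'} → o ↭ o' → Balanced o → Balanced o'
balanced-resp-↭ o↭o' bal = balanced λ α →
  trans (sym (countOcc-↭ true α o↭o')) (trans (balanced-at bal α) (countOcc-↭ false α o↭o'))

balanced-cancelʳ : ∀ {o} o' → Balanced o' → Balanced (o ++ o') → Balanced o
balanced-cancelʳ {o} o' (balanced bal') (balanced bal) = balanced λ α →
  ℕ.+-cancelʳ-≡ (countOcc true α o') _ _ (begin
    countOcc true α o + countOcc true α o'   ≡⟨ countOcc-++ true α o o' ⟨
    countOcc true α (o ++ o')                ≡⟨ bal α ⟩
    countOcc false α (o ++ o')               ≡⟨ countOcc-++ false α o o' ⟩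
    countOcc false α o + countOcc false α o' ≡⟨ cong (countOcc false α o +_) (bal' α) ⟨
    countOcc false α o + countOcc true α o'  ∎)
  where open ≡-Reasoning

record VanishesOn (P : ℕ → Set) (o : Occurrences) : Set where
  constructor vanishing
  field vanishes-at : ∀ b α → P α → countOcc b α o ≡ 0

open VanishesOn

module _ {P : ℕ → Set} where

  vanishesOn-resp-↭ : ∀ {o o'} → o ↭ o' → VanishesOn P o → VanishesOn P o'
  vanishesOn-resp-↭ o↭o' v = vanishing λ b α Pα →
    trans (sym (countOcc-↭ b α o↭o')) (vanishes-at v b α Pα)

  vanishesOn-++⁺ : ∀ {o o'} → VanishesOn P o → VanishesOn P o' → VanishesOn P (o ++ o')
  vanishesOn-++⁺ {o} {o'} v v' = vanishing λ b α Pα →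
    trans (countOcc-++ b α o o') (cong₂ _+_ (vanishes-at v b α Pα) (vanishes-at v' b α Pα))

  vanishesOn-++⁻ : ∀ o {o'} → VanishesOn P (o ++ o') → VanishesOn P o × VanishesOn P o'
  vanishesOn-++⁻ o {o'} v =
    vanishing (λ b α Pα → ℕ.m+n≡0⇒m≡0 (countOcc b α o) (sum≡0 b α Pα)) ,
    vanishing (λ b α Pα → ℕ.m+n≡0⇒n≡0 (countOcc b α o) (sum≡0 b α Pα))
    where
    sum≡0 : ∀ b α → P α → countOcc b α o + countOcc b α o' ≡ 0
    sum≡0 b α Pα = trans (sym (countOcc-++ b α o o')) (vanishes-at v b α Pα)

vanishesOn-mono : ∀ {P Q : ℕ → Set} {o} → (∀ {α} → Q α → P α) → VanishesOn P o → VanishesOn Q o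
vanishesOn-mono Q⇒P v = vanishing λ b α Qα → vanishes-at v b α (Q⇒P Qα)

balanced-++⁻ : ∀ n {o o'} → VanishesOn (n ≤_) o → VanishesOn (_< n) o' →
               Balanced (o ++ o') → Balanced o × Balanced o'
balanced-++⁻ n {o} {o'} (vanishing v) (vanishing v') (balanced bal) =
  balanced balancedˡ , balanced balancedʳ
  where
  sums : ∀ α → countOcc true α o + countOcc true α o' ≡ countOcc false α o + countOcc false α o'
  sums α = trans (sym (countOcc-++ true α o o')) (trans (bal α) (countOcc-++ false α o o'))
  cancelʳ : ∀ {a b c d} → c ≡ 0 → d ≡ 0 → a + c ≡ b + d → a ≡ b
  cancelʳ {a} {b} refl refl = ℕ.+-cancelʳ-≡ 0 a b
  cancelˡ : ∀ {a b c d} → a ≡ 0 → b ≡ 0 → a + c ≡ b + d → c ≡ d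
  cancelˡ refl refl sum≡ = sum≡
  balancedˡ : ∀ α → countOcc true α o ≡ countOcc false α o
  balancedˡ α with α ℕ.<? n
  ... | yes α<n = cancelʳ (v' true α α<n) (v' false α α<n) (sums α)
  ... | no α≮n  = trans (v true α (ℕ.≮⇒≥ α≮n)) (sym (v false α (ℕ.≮⇒≥ α≮n)))
  balancedʳ : ∀ α → countOcc true α o' ≡ countOcc false α o'
  balancedʳ α with α ℕ.<? n
  ... | yes α<n = trans (v' true α α<n) (sym (v' false α α<n))
  ... | no α≮n  = cancelˡ (v true α (ℕ.≮⇒≥ α≮n)) (v false α (ℕ.≮⇒≥ α≮n)) (sums α)

unbalanced-lone : ∀ b a {o} → VanishesOn (_≡ a) o → ¬ Balanced (o ++ [ (b , a) ])
unbalanced-lone b a {o} v bal =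
  lone b (trans (sym (count-at true)) (trans (balanced-at bal a) (count-at false)))
  where
  count-at : ∀ b' → countOcc b' a (o ++ [ (b , a) ]) ≡ countOcc b' a [ (b , a) ]
  count-at b' = trans (countOcc-++ b' a o [ (b , a) ])
                      (cong (_+ countOcc b' a [ (b , a) ]) (vanishes-at v b' a refl))
  lone : ∀ b → countOcc true a [ (b , a) ] ≢ countOcc false a [ (b , a) ]
  lone true  eq = ℕ.1+n≢0 (trans (sym (countOcc-self true a)) eq)
  lone false eq = ℕ.1+n≢0 (sym (trans eq (countOcc-self false a)))

ClosedOcc : Occurrences → Set
ClosedOcc o = ∀ α → α ∈ map proj₂ o → (countOcc true α o ≡ 1) × (countOcc false α o ≡ 1)

closedOcc⇒balanced : ∀ {o} → ClosedOcc o → Balanced o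
closedOcc⇒balanced {o} closed = balanced balanced-at′
  where
  balanced-at′ : ∀ α → countOcc true α o ≡ countOcc false α o
  balanced-at′ α with α ∈? map proj₂ o
  ... | yes α∈o = trans (proj₁ (closed α α∈o)) (sym (proj₂ (closed α α∈o)))
  ... | no α∉o  = trans (countOcc-∉ true α o α∉o) (sym (countOcc-∉ false α o α∉o))

record Linear (s s' : ℕ) (o : Occurrences) : Set where
  field
    bounded : s ≤ s'
    once : ∀ b α → s ≤ α → α < s' → countOcc b α o ≡ 1
    elsewhere : VanishesOn (λ α → α < s ⊎ s' ≤ α) o

  vanishes-before : VanishesOn (_< s) o
  vanishes-before = vanishesOn-mono inj₁ elsewhere

  vanishes-after : VanishesOn (s' ≤_) o
  vanishes-after = vanishesOn-mono inj₂ elsewhere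

  closedOcc : ClosedOcc o
  closedOcc α α∈o with countOcc-∈ α o α∈o
  ... | b , count≢0 with α ℕ.<? s | s' ℕ.≤? α
  ...   | yes α<s | _        = ⊥-elim (count≢0 (vanishes-at vanishes-before b α α<s))
  ...   | no _    | yes s'≤α = ⊥-elim (count≢0 (vanishes-at vanishes-after b α s'≤α))
  ...   | no α≮s  | no s'≰α  =
    once true α (ℕ.≮⇒≥ α≮s) (ℕ.≰⇒> s'≰α) , once false α (ℕ.≮⇒≥ α≮s) (ℕ.≰⇒> s'≰α)

open Linear using (bounded; once; elsewhere)

linear-resp-↭ : ∀ {s s' o o'} → o ↭ o' → Linear s s' o → Linear s s' o'
linear-resp-↭ o↭o' lin = record
  { bounded = bounded lin
  ; once = λ b α s≤α α<s' → trans (sym (countOcc-↭ b α o↭o')) (once lin b α s≤α α<s')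
  ; elsewhere = vanishesOn-resp-↭ o↭o' (elsewhere lin)
  }

linear-[] : ∀ s → Linear s s []
linear-[] s = record
  { bounded = ℕ.≤-refl
  ; once = λ b α s≤α α<s → ⊥-elim (ℕ.<⇒≱ α<s s≤α)
  ; elsewhere = vanishing λ b α _ → refl
  }

linear-pair : ∀ a → Linear a (suc a) ((false , a) ∷ (true , a) ∷ [])
linear-pair a = record
  { bounded = ℕ.n≤1+n a
  ; once = λ b α a≤α α<1+a → trans (countOcc-∷ b α (false , a) [ (true , a) ])
                                   (once-each b (ℕ.≤-antisym a≤α (ℕ.≤-pred α<1+a)))
  ; elsewhere = vanishing λ b α outside → trans (countOcc-∷ b α (false , a) [ (true , a) ])
      (cong₂ _+_ (countOcc-other b α false a (≢a outside ∘ cong proj₂))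
                 (countOcc-other b α true a (≢a outside ∘ cong proj₂)))
  }
  where
  once-each : ∀ b {α} → a ≡ α → countOcc b α [ (false , a) ] + countOcc b α [ (true , a) ] ≡ 1
  once-each true  refl = cong₂ _+_ (countOcc-other true a false a λ ()) (countOcc-self true a)
  once-each false refl = cong₂ _+_ (countOcc-self false a) (countOcc-other false a true a λ ())
  ≢a : ∀ {α} → α < a ⊎ suc a ≤ α → α ≢ a
  ≢a (inj₁ α<a)   refl = ℕ.n≮n a α<a
  ≢a (inj₂ 1+a≤α) refl = ℕ.n≮n a 1+a≤α

linear-++ : ∀ {s s₁ s₂ o o'} → Linear s s₁ o → Linear s₁ s₂ o' → Linear s s₂ (o ++ o')
linear-++ {s} {s₁} {s₂} {o} {o'} lin lin' = record
  { bounded = ℕ.≤-trans (bounded lin) (bounded lin')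
  ; once = once-++
  ; elsewhere = vanishesOn-++⁺
      (vanishesOn-mono (Sum.map₂ (ℕ.≤-trans (bounded lin'))) (elsewhere lin))
      (vanishesOn-mono (Sum.map₁ (λ α<s → ℕ.<-≤-trans α<s (bounded lin))) (elsewhere lin'))
  }
  where
  once-++ : ∀ b α → s ≤ α → α < s₂ → countOcc b α (o ++ o') ≡ 1
  once-++ b α s≤α α<s₂ with α ℕ.<? s₁
  ... | yes α<s₁ = trans (countOcc-++ b α o o')
      (cong₂ _+_ (once lin b α s≤α α<s₁) (vanishes-at (Linear.vanishes-before lin') b α α<s₁))
  ... | no α≮s₁  = trans (countOcc-++ b α o o')
      (cong₂ _+_ (vanishes-at (Linear.vanishes-after lin) b α (ℕ.≮⇒≥ α≮s₁))
                 (once lin' b α (ℕ.≮⇒≥ α≮s₁) α<s₂))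

occU-++ : ∀ b (xs ys : List Ty) → occU b (xs ++ ys) ≡ occU b xs ++ occU b ys
occU-++ b []       ys = refl
occU-++ b (x ∷ xs) ys =
  trans (cong (occT b x ++_) (occU-++ b xs ys)) (sym (List.++-assoc (occT b x) (occU b xs) (occU b ys)))

occU-↭ : ∀ b {xs ys : List Ty} → xs ↭ ys → occU b xs ↭ occU b ys
occU-↭ b ↭.refl         = ↭-refl
occU-↭ b (↭.prep x p)   = ++⁺ˡ (occT b x) (occU-↭ b p)
occU-↭ b (↭.swap x y p) =
  ↭-trans (shifts (occT b x) (occT b y)) (++⁺ˡ (occT b y) (++⁺ˡ (occT b x) (occU-↭ b p)))
occU-↭ b (↭.trans p q)  = ↭-trans (occU-↭ b p) (occU-↭ b q)

occC-concat : ∀ b (Γ : Ctx) → occC b Γ ≡ occU b (concat Γ)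
occC-concat b []      = refl
occC-concat b (u ∷ Γ) = trans (cong (occU b u ++_) (occC-concat b Γ)) (sym (occU-++ b u (concat Γ)))

-- X ranges over the sub-multisets of F and Y over their complements; the two conditions are
-- what minimal closedness asks of held types of the forms ⟨Γ'⟩⇒φ and ⟨Γ'⟩⇒ respectively.
Minimal : List Ty → Occurrences → Set
Minimal F o = ∀ X Y → X ++ Y ↭ F →
  (Balanced (occU false X ++ o) → Y ≡ []) × (Balanced (occU false X) → X ≡ [])

vanishesOn-select : ∀ {P} X {Y F o} → X ++ Y ↭ F →
                    VanishesOn P (occU false F ++ o) → VanishesOn P (occU false X ++ o)
vanishesOn-select X {Y} {F} {o} XY↭F v =
  proj₂ (vanishesOn-++⁻ (occU false Y) (vanishesOn-resp-↭ reorder v))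
  where
  open PermutationReasoning
  reorder : occU false F ++ o ↭ occU false Y ++ (occU false X ++ o)
  reorder = begin
    occU false F ++ o                    ↭⟨ ++⁺ʳ o (occU-↭ false (↭-sym XY↭F)) ⟩
    occU false (X ++ Y) ++ o             ≡⟨ cong (_++ o) (occU-++ false X Y) ⟩
    (occU false X ++ occU false Y) ++ o  ↭⟨ ↭-Algebra.xy∙z≈y∙xz (occU false X) (occU false Y) o ⟩
    occU false Y ++ (occU false X ++ o)  ∎

minimal-resp-↭ : ∀ {F F' o} → F ↭ F' → Minimal F o → Minimal F' o
minimal-resp-↭ F↭F' min X Y XY↭F' = min X Y (↭-trans XY↭F' (↭-sym F↭F'))

minimal-[] : Minimal [] []
minimal-[] X Y XY↭[] = (λ _ → List.++-conicalʳ X Y XY≡[]) , (λ _ → List.++-conicalˡ X Y XY≡[])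
  where
  XY≡[] : X ++ Y ≡ []
  XY≡[] = ↭-empty-inv XY↭[]

minimal-lam : ∀ u {F o} → Minimal (u ++ F) o → Minimal F (occU false u ++ o)
minimal-lam u {F} {o} min X Y XY↭F =
  (λ bal → proj₁ (min (u ++ X) Y (↭-trans (++-assoc u X Y) (++⁺ˡ u XY↭F))) (balanced-resp-↭ reorder bal)) ,
  proj₂ (min X (u ++ Y) (↭-trans (shifts X u) (++⁺ˡ u XY↭F)))
  where
  open PermutationReasoning
  reorder : occU false X ++ (occU false u ++ o) ↭ occU false (u ++ X) ++ o
  reorder = begin
    occU false X ++ (occU false u ++ o)  ↭⟨ ↭-Algebra.x∙yz≈yx∙z (occU false X) (occU false u) o ⟩
    (occU false u ++ occU false X) ++ o  ≡⟨ cong (_++ o) (occU-++ false u X) ⟨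
    occU false (u ++ X) ++ o             ∎

minimal-++ : ∀ n {F F' o o'} →
             VanishesOn (n ≤_) (occU false F ++ o) → VanishesOn (_< n) (occU false F' ++ o') →
             Minimal F o → Minimal F' o' → Minimal (F ++ F') (o ++ o')
minimal-++ n {F} {F'} {o} {o'} v v' min min' X Y XY↭ = complement-empty , empty
  where
  open Refinement (↭-refine F {X = X} XY↭)
  open PermutationReasoning
  v₁ : VanishesOn (n ≤_) (occU false X₁ ++ o)
  v₁ = vanishesOn-select X₁ ↭P v
  v₂ : VanishesOn (_< n) (occU false X₂ ++ o')
  v₂ = vanishesOn-select X₂ ↭Q v'
  occX↭ : occU false X ↭ occU false X₁ ++ occU false X₂
  occX↭ = ↭-trans (occU-↭ false X↭) (↭-reflexive (occU-++ false X₁ X₂))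
  reorder : occU false X ++ (o ++ o') ↭ (occU false X₁ ++ o) ++ (occU false X₂ ++ o')
  reorder = begin
    occU false X ++ (o ++ o')                     ↭⟨ ++⁺ʳ (o ++ o') occX↭ ⟩
    (occU false X₁ ++ occU false X₂) ++ (o ++ o') ↭⟨ ↭-Algebra.interchange (occU false X₁) _ o o' ⟩
    (occU false X₁ ++ o) ++ (occU false X₂ ++ o') ∎
  empty-++ : ∀ {Z Z₁ Z₂} → Z ↭ Z₁ ++ Z₂ → Z₁ ≡ [] → Z₂ ≡ [] → Z ≡ []
  empty-++ Z↭ refl refl = ↭-empty-inv Z↭
  complement-empty : Balanced (occU false X ++ (o ++ o')) → Y ≡ []
  complement-empty bal with balanced-++⁻ n v₁ v₂ (balanced-resp-↭ reorder bal)
  ... | bal₁ , bal₂ = empty-++ Y↭ (proj₁ (min X₁ Y₁ ↭P) bal₁) (proj₁ (min' X₂ Y₂ ↭Q) bal₂)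
  empty : Balanced (occU false X) → X ≡ []
  empty bal with balanced-++⁻ n (proj₁ (vanishesOn-++⁻ (occU false X₁) v₁))
                                (proj₁ (vanishesOn-++⁻ (occU false X₂) v₂)) (balanced-resp-↭ occX↭ bal)
  ... | bal₁ , bal₂ = empty-++ X↭ (proj₂ (min X₁ Y₁ ↭P) bal₁) (proj₂ (min' X₂ Y₂ ↭Q) bal₂)

-- A is the head type σ₁ → ⋯ → σₘ → a with a fresh: a selection balanced with a⁺ must take A,
-- and a selection containing A is never balanced on its own.
minimal-head : ∀ a {A F o} → VanishesOn (_≡ a) (occU false F ++ o) → occT false A ↭ o ++ [ (false , a) ] →
               Minimal F o → Minimal (A ∷ F) [ (true , a) ]
minimal-head a {A} {F} {o} fresh occA min X Y XY↭ with ↭-∷-split XY↭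
... | inj₁ (X' , X↭ , X'Y↭F) =
  (λ bal → proj₁ (min X' Y X'Y↭F)
             (balanced-cancelʳ pair (closedOcc⇒balanced (Linear.closedOcc (linear-pair a)))
                                    (balanced-resp-↭ reorder bal))) ,
  (λ bal → ⊥-elim (unbalanced-lone false a (vanishesOn-select X' X'Y↭F fresh) (balanced-resp-↭ occX↭ bal)))
  where
  open PermutationReasoning
  pair : Occurrences
  pair = (false , a) ∷ (true , a) ∷ []
  occX↭ : occU false X ↭ (occU false X' ++ o) ++ [ (false , a) ]
  occX↭ = begin
    occU false X                             ↭⟨ occU-↭ false X↭ ⟩
    occT false A ++ occU false X'            ↭⟨ ++⁺ʳ (occU false X') occA ⟩
    (o ++ [ (false , a) ]) ++ occU false X'  ↭⟨ ↭-Algebra.xy∙z≈zx∙y o [ (false , a) ] (occU false X') ⟩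
    (occU false X' ++ o) ++ [ (false , a) ]  ∎
  reorder : occU false X ++ [ (true , a) ] ↭ (occU false X' ++ o) ++ pair
  reorder = begin
    occU false X ++ [ (true , a) ]                               ↭⟨ ++⁺ʳ [ (true , a) ] occX↭ ⟩
    ((occU false X' ++ o) ++ [ (false , a) ]) ++ [ (true , a) ]  ↭⟨ ++-assoc (occU false X' ++ o) _ _ ⟩
    (occU false X' ++ o) ++ pair                                 ∎
... | inj₂ (Y' , Y↭ , XY'↭F) =
  (λ bal → ⊥-elim (unbalanced-lone true a
                     (proj₁ (vanishesOn-++⁻ (occU false X) (vanishesOn-select X XY'↭F fresh))) bal)) ,
  proj₂ (min X Y' XY'↭F)

concat-∧C : ∀ Γ Δ → concat (Γ ∧C Δ) ↭ concat Γ ++ concat Δ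
concat-∧C []      Δ       = ↭-refl
concat-∧C (u ∷ Γ) []      = ↭-sym (++-identityʳ (u ++ concat Γ))
concat-∧C (u ∷ Γ) (v ∷ Δ) =
  ↭-trans (++⁺ˡ (u ++ v) (concat-∧C Γ Δ)) (↭-Algebra.interchange u v (concat Γ) (concat Δ))

concat-≈C : ∀ {Γ Δ} → Γ ≈C Δ → concat Γ ↭ concat Δ
concat-≈C []          = ↭-refl
concat-≈C (u↭v ∷ Γ≈Δ) = ++⁺ u↭v (concat-≈C Γ≈Δ)

concat-held : ∀ Γ' Δ {Γ} → (Γ' ∧C Δ) ≈C Γ → concat Γ' ++ concat Δ ↭ concat Γ
concat-held Γ' Δ Γ'∧Δ≈Γ = ↭-trans (↭-sym (concat-∧C Γ' Δ)) (concat-≈C Γ'∧Δ≈Γ)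

concat-foldl-∧C : ∀ Γ Γs → concat (foldl _∧C_ Γ Γs) ↭ concat Γ ++ concatMap concat Γs
concat-foldl-∧C Γ []       = ↭-sym (++-identityʳ (concat Γ))
concat-foldl-∧C Γ (Δ ∷ Γs) = begin
  concat (foldl _∧C_ (Γ ∧C Δ) Γs)                ↭⟨ concat-foldl-∧C (Γ ∧C Δ) Γs ⟩
  concat (Γ ∧C Δ) ++ concatMap concat Γs         ↭⟨ ++⁺ʳ (concatMap concat Γs) (concat-∧C Γ Δ) ⟩
  (concat Γ ++ concat Δ) ++ concatMap concat Γs  ↭⟨ ++-assoc (concat Γ) (concat Δ) (concatMap concat Γs) ⟩
  concat Γ ++ concat Δ ++ concatMap concat Γs    ∎
  where open PermutationReasoning

concat-ωs : ∀ k u → concat (ωs k [ u ]) ≡ u ++ []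
concat-ωs zero    u = refl
concat-ωs (suc k) u = concat-ωs k u

foldl-∧C-preserves : ∀ (P : Ctx → Set) → (∀ Γ Δ → P Γ → P Δ → P (Γ ∧C Δ)) →
                     ∀ {Γ Γs} → P Γ → All P Γs → P (foldl _∧C_ Γ Γs)
foldl-∧C-preserves P P-∧C                 PΓ []         = PΓ
foldl-∧C-preserves P P-∧C {Γ} {Δ ∷ _} PΓ (PΔ ∷ PΓs) = foldl-∧C-preserves P P-∧C (P-∧C Γ Δ PΓ PΔ) PΓs

isCtxC-∧C : ∀ Γ Δ → IsCtxC Γ → IsCtxC Δ → IsCtxC (Γ ∧C Δ)
isCtxC-∧C []      _       _         CΔ        = CΔ
isCtxC-∧C (_ ∷ _) []      CΓ        _         = CΓ
isCtxC-∧C (_ ∷ Γ) (_ ∷ Δ) (Cu ∷ CΓ) (Cv ∷ CΔ) = All.++⁺ Cu Cv ∷ isCtxC-∧C Γ Δ CΓ CΔ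

isCtxC-ωs : ∀ k {u} → IsUC u → IsCtxC (ωs k [ u ])
isCtxC-ωs k Cu = All.++⁺ (All.replicate⁺ k []) (Cu ∷ [])

-- Infer never ends a context with ω; this is what rules out a held ⟨Γ'⟩⇒φ with Γ ≈ Γ' ∧ ω^k, Γ' ≠ Γ.
NoTrailingω : Ctx → Set
NoTrailingω []          = ⊤
NoTrailingω (u ∷ [])    = u ≢ []
NoTrailingω (_ ∷ v ∷ Γ) = NoTrailingω (v ∷ Γ)

noTrailingω-tail : ∀ u Γ → NoTrailingω (u ∷ Γ) → NoTrailingω Γ
noTrailingω-tail u []      _  = tt
noTrailingω-tail u (_ ∷ _) nt = nt

noTrailingω-∧C : ∀ Γ Δ → NoTrailingω Γ → NoTrailingω Δ → NoTrailingω (Γ ∧C Δ)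
noTrailingω-∧C []          _           _    ntΔ = ntΔ
noTrailingω-∧C (_ ∷ _)     []          ntΓ  _   = ntΓ
noTrailingω-∧C (u ∷ [])    (v ∷ [])    u≢[] _   = u≢[] ∘ List.++-conicalˡ u v
noTrailingω-∧C (_ ∷ [])    (_ ∷ _ ∷ _) _    ntΔ = ntΔ
noTrailingω-∧C (_ ∷ _ ∷ _) (_ ∷ [])    ntΓ  _   = ntΓ
noTrailingω-∧C (_ ∷ u ∷ Γ) (_ ∷ v ∷ Δ) ntΓ  ntΔ = noTrailingω-∧C (u ∷ Γ) (v ∷ Δ) ntΓ ntΔ

noTrailingω-ωs : ∀ k {u} → u ≢ [] → NoTrailingω (ωs k [ u ])
noTrailingω-ωs zero          u≢[] = u≢[]
noTrailingω-ωs (suc zero)    u≢[] = u≢[]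
noTrailingω-ωs (suc (suc k)) u≢[] = noTrailingω-ωs (suc k) u≢[]

Allω : Ctx → Set
Allω = All λ (u : U) → u ≡ []

concat≡[]⇒allω : ∀ Γ → concat Γ ≡ [] → Allω Γ
concat≡[]⇒allω []      _  = []
concat≡[]⇒allω (u ∷ Γ) eq =
  List.++-conicalˡ u (concat Γ) eq ∷ concat≡[]⇒allω Γ (List.++-conicalʳ u (concat Γ) eq)

allω⇒replicate : ∀ {Γ} → Allω Γ → Γ ≡ replicate (length Γ) []
allω⇒replicate []         = refl
allω⇒replicate (refl ∷ ω) = cong ([] ∷_) (allω⇒replicate ω)

allω-resp-≈C : ∀ {Δ Γ} → Δ ≈C Γ → Allω Δ → Allω Γ
allω-resp-≈C []          []         = []
allω-resp-≈C (u↭v ∷ Δ≈Γ) (refl ∷ ω) = ↭-empty-inv (↭-sym u↭v) ∷ allω-resp-≈C Δ≈Γ ω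

noTrailingω-allω : ∀ {Γ} → NoTrailingω Γ → Allω Γ → Γ ≡ []
noTrailingω-allω {[]}        _    _           = refl
noTrailingω-allω {u ∷ []}    u≢[] (u≡[] ∷ []) = ⊥-elim (u≢[] u≡[])
noTrailingω-allω {u ∷ v ∷ Γ} nt   (_ ∷ ω) with noTrailingω-allω {v ∷ Γ} nt ω
... | ()

∧C-allω-≈C : ∀ {Γ' Δ Γ} → Allω Δ → NoTrailingω Γ → (Γ' ∧C Δ) ≈C Γ → Γ' ≈C Γ
∧C-allω-≈C {[]} ωΔ ntΓ Δ≈Γ with noTrailingω-allω ntΓ (allω-resp-≈C Δ≈Γ ωΔ)
... | refl = []
∧C-allω-≈C {_ ∷ _} {[]} _ _ Γ'≈Γ = Γ'≈Γ
∧C-allω-≈C {u ∷ _} {_ ∷ _} {w ∷ Γ} (refl ∷ ωΔ) ntΓ (u↭w ∷ Γ'∧Δ≈Γ) =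
  ↭-trans (↭-sym (++-identityʳ u)) u↭w ∷ ∧C-allω-≈C ωΔ (noTrailingω-tail w Γ ntΓ) Γ'∧Δ≈Γ

minimallyClosed : ∀ {Γ φ} → NoTrailingω Γ → Minimal (concat Γ) (occT true φ) → MinimallyClosed Γ φ
minimallyClosed {Γ} {φ} ntΓ min (⟨ Γ' ⟩⇒ φ') _ ((refl , _ , Δ , Γ'∧Δ≈Γ) , not-same) closed =
  not-same (∧C-allω-≈C (concat≡[]⇒allω Δ Δ-empty) ntΓ Γ'∧Δ≈Γ , refl)
  where
  Δ-empty : concat Δ ≡ []
  Δ-empty = proj₁ (min (concat Γ') (concat Δ) (concat-held Γ' Δ Γ'∧Δ≈Γ))
                  (subst (λ o → Balanced (o ++ occT true φ)) (occC-concat false Γ')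
                         (closedOcc⇒balanced {occC false Γ' ++ occT true φ} closed))
minimallyClosed ntΓ min (⟨ [] ⟩⇒∅) (_ , ())
minimallyClosed ntΓ min (⟨ u ∷ Γ' ⟩⇒∅) _ ((not-ωᵏ , Δ , Γ'∧Δ≈Γ) , _) closed =
  not-ωᵏ (length Γ') (allω⇒replicate (concat≡[]⇒allω (u ∷ Γ') Γ'-empty))
  where
  Γ'-empty : concat (u ∷ Γ') ≡ []
  Γ'-empty = proj₂ (min (concat (u ∷ Γ')) (concat Δ) (concat-held (u ∷ Γ') Δ Γ'∧Δ≈Γ))
                   (subst Balanced (occC-concat false (u ∷ Γ'))
                          (closedOcc⇒balanced {occC false (u ∷ Γ')} closed))

∈-LCtx : ∀ {τ u Γ} → τ ∈ u → u ∈ Γ → u ∈ LCtx Γ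
∈-LCtx {Γ = (_ ∷ _) ∷ _} _   (here refl) = here refl
∈-LCtx {Γ = [] ∷ _}      ()  (here refl)
∈-LCtx {Γ = [] ∷ _}      τ∈u (there u∈Γ) = ∈-LCtx τ∈u u∈Γ
∈-LCtx {Γ = (_ ∷ _) ∷ _} τ∈u (there u∈Γ) = there (∈-LCtx τ∈u u∈Γ)

LCT-lam : ∀ u Γ σ → LCT (⟨ u ∷ Γ ⟩⇒ σ) ↭ LCT (⟨ Γ ⟩⇒ (u ⇒ σ))
LCT-lam []      Γ σ = ↭-refl
LCT-lam (τ ∷ v) Γ σ = ↭-sym (shift (τ ∷ v) (LCtx Γ) (LTy σ))

final-arrows : ∀ σs a → final (arrows σs (tv a)) ≡ a
final-arrows []       a = refl
final-arrows (_ ∷ σs) a = final-arrows σs a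

isTC-arrows : ∀ {σs} a → All IsTNF σs → IsTC (arrows σs (tv a))
isTC-arrows a []           = tc-var a
isTC-arrows a (NFσ ∷ NFσs) = tc-arr NFσ (isTC-arrows a NFσs)

occT-arrows : ∀ σs a → occT false (arrows σs (tv a)) ≡ concatMap (occT true) σs ++ [ (false , a) ]
occT-arrows []       a = refl
occT-arrows (σ ∷ σs) a = begin
  (occT true σ ++ []) ++ occT false (arrows σs (tv a))          ≡⟨ cong (_++ _) (List.++-identityʳ (occT true σ)) ⟩
  occT true σ ++ occT false (arrows σs (tv a))                  ≡⟨ cong (occT true σ ++_) (occT-arrows σs a) ⟩
  occT true σ ++ (concatMap (occT true) σs ++ [ (false , a) ])  ≡⟨ List.++-assoc (occT true σ) _ _ ⟨
  (occT true σ ++ concatMap (occT true) σs) ++ [ (false , a) ]  ∎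
  where open ≡-Reasoning

-- The invariant of infer N s = (Γ , φ , s'), which draws the fresh variables s, …, s' - 1.
record Inferred (s s' : ℕ) (Γ : Ctx) (φ : Ty) : Set where
  field
    ctx-C : IsCtxC Γ
    type-NF : IsTNF φ
    no-trailing-ω : NoTrailingω Γ
    linear : Linear s s' (occCT (⟨ Γ ⟩⇒ φ))
    finally-closed : FinallyClosed Γ φ
    minimal : Minimal (concat Γ) (occT true φ)

  complete : IsCType (⟨ Γ ⟩⇒ φ) × Complete Γ φ
  complete = (ctx-C , type-NF) , Linear.closedOcc linear , finally-closed , minimallyClosed no-trailing-ω minimal

inferred-lam : ∀ {s s' u Γ σ} → Inferred s s' (u ∷ Γ) σ → Inferred s s' Γ (u ⇒ σ)
inferred-lam {u = u} {Γ} {σ} inf = record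
  { ctx-C = All.tail ctx-C
  ; type-NF = tnf-arr (All.head ctx-C) type-NF
  ; no-trailing-ω = noTrailingω-tail u Γ no-trailing-ω
  ; linear = linear-resp-↭ (↭-Algebra.xy∙z≈y∙xz (occU false u) (occC false Γ) (occT true σ)) linear
  ; finally-closed = let (v , v∈L , rest) = finally-closed in v , ∈-resp-↭ (LCT-lam u Γ σ) v∈L , rest
  ; minimal = minimal-lam u minimal
  }
  where open Inferred inf

inferred-lam-ω : ∀ {s s' σ} → Inferred s s' [] σ → Inferred s s' [] ([] ⇒ σ)
inferred-lam-ω inf = record
  { ctx-C = ctx-C ; type-NF = tnf-arr [] type-NF ; no-trailing-ω = no-trailing-ω
  ; linear = linear ; finally-closed = finally-closed ; minimal = minimal
  }
  where open Inferred inf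

argTypes : List (Ctx × Ty) → List Ty
argTypes args = concatMap concat (map proj₁ args)

argOcc : List (Ctx × Ty) → Occurrences
argOcc args = concatMap (occT true) (map proj₂ args)

argTypes-∷ʳ : ∀ args Γ σ → argTypes (args ++ [ (Γ , σ) ]) ≡ argTypes args ++ concat Γ
argTypes-∷ʳ []                Γ σ = List.++-identityʳ (concat Γ)
argTypes-∷ʳ ((Γ' , _) ∷ args) Γ σ = trans (cong (concat Γ' ++_) (argTypes-∷ʳ args Γ σ))
                                          (sym (List.++-assoc (concat Γ') (argTypes args) (concat Γ)))

argOcc-∷ʳ : ∀ args Γ σ → argOcc (args ++ [ (Γ , σ) ]) ≡ argOcc args ++ occT true σ
argOcc-∷ʳ []                Γ σ = List.++-identityʳ (occT true σ)
argOcc-∷ʳ ((_ , σ') ∷ args) Γ σ = trans (cong (occT true σ' ++_) (argOcc-∷ʳ args Γ σ))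
                                        (sym (List.++-assoc (occT true σ') (argOcc args) (occT true σ)))

record InferredArgs (s s' : ℕ) (args : List (Ctx × Ty)) : Set where
  field
    ctxs-C : All (IsCtxC ∘ proj₁) args
    types-NF : All (IsTNF ∘ proj₂) args
    no-trailing-ω : All (NoTrailingω ∘ proj₁) args
    linear : Linear s s' (occU false (argTypes args) ++ argOcc args)
    minimal : Minimal (argTypes args) (argOcc args)

inferredArgs-[] : ∀ s → InferredArgs s s []
inferredArgs-[] s = record
  { ctxs-C = [] ; types-NF = [] ; no-trailing-ω = [] ; linear = linear-[] s ; minimal = minimal-[] }

inferredArgs-∷ʳ : ∀ {s s₁ s₂ args Γ σ} → InferredArgs s s₁ args → Inferred s₁ s₂ Γ σ →
                  InferredArgs s s₂ (args ++ [ (Γ , σ) ])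
inferredArgs-∷ʳ {s} {s₁} {s₂} {args} {Γ} {σ} infs inf = record
  { ctxs-C = All.++⁺ Args.ctxs-C (Arg.ctx-C ∷ [])
  ; types-NF = All.++⁺ Args.types-NF (Arg.type-NF ∷ [])
  ; no-trailing-ω = All.++⁺ Args.no-trailing-ω (Arg.no-trailing-ω ∷ [])
  ; linear = linear-resp-↭ reorder (linear-++ Args.linear linear')
  ; minimal = subst₂ Minimal (sym (argTypes-∷ʳ args Γ σ)) (sym (argOcc-∷ʳ args Γ σ))
      (minimal-++ s₁ (Linear.vanishes-after Args.linear) (Linear.vanishes-before linear') Args.minimal Arg.minimal)
  }
  where
  module Args = InferredArgs infs
  module Arg = Inferred inf
  open PermutationReasoning
  G : Occurrences
  G = occU false (argTypes args)
  linear' : Linear s₁ s₂ (occU false (concat Γ) ++ occT true σ)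
  linear' = subst (λ o → Linear s₁ s₂ (o ++ occT true σ)) (occC-concat false Γ) Arg.linear
  reorder : (G ++ argOcc args) ++ (occU false (concat Γ) ++ occT true σ) ↭
            occU false (argTypes (args ++ [ (Γ , σ) ])) ++ argOcc (args ++ [ (Γ , σ) ])
  reorder = begin
    (G ++ argOcc args) ++ (occU false (concat Γ) ++ occT true σ)
      ↭⟨ ↭-Algebra.interchange G (argOcc args) (occU false (concat Γ)) (occT true σ) ⟩
    (G ++ occU false (concat Γ)) ++ (argOcc args ++ occT true σ)
      ≡⟨ cong (_++ _) (occU-++ false (argTypes args) (concat Γ)) ⟨
    occU false (argTypes args ++ concat Γ) ++ (argOcc args ++ occT true σ)
      ≡⟨ cong₂ (λ F o → occU false F ++ o) (argTypes-∷ʳ args Γ σ) (argOcc-∷ʳ args Γ σ) ⟨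
    occU false (argTypes (args ++ [ (Γ , σ) ])) ++ argOcc (args ++ [ (Γ , σ) ]) ∎

inferred-app : ∀ {s s' args} k → InferredArgs s s' args →
               let A = arrows (map proj₂ args) (tv s') in
               Inferred s (suc s') (foldl _∧C_ (ωs k [ [ A ] ]) (map proj₁ args)) (tv s')
inferred-app {s} {s'} {args} k infs = record
  { ctx-C = foldl-∧C-preserves IsCtxC isCtxC-∧C
              (isCtxC-ωs k (isTC-arrows s' (All.map⁺ types-NF) ∷ [])) (All.map⁺ ctxs-C)
  ; type-NF = tnf-var s'
  ; no-trailing-ω = foldl-∧C-preserves NoTrailingω noTrailingω-∧C
                      (noTrailingω-ωs k λ ()) (All.map⁺ no-trailing-ω)
  ; linear = linear-resp-↭ reorder (linear-++ linear (linear-pair s'))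
  ; finally-closed = finally-closed
  ; minimal = minimal-resp-↭ (↭-sym concat-Γ)
      (minimal-head s' (vanishesOn-mono (λ { refl → ℕ.≤-refl }) (Linear.vanishes-after linear))
                    (↭-reflexive (occT-arrows (map proj₂ args) s')) minimal)
  }
  where
  open InferredArgs infs
  open PermutationReasoning
  A : Ty
  A = arrows (map proj₂ args) (tv s')
  Γ : Ctx
  Γ = foldl _∧C_ (ωs k [ [ A ] ]) (map proj₁ args)
  G : Occurrences
  G = occU false (argTypes args)
  concat-Γ : concat Γ ↭ A ∷ argTypes args
  concat-Γ = subst (λ F → concat Γ ↭ F ++ argTypes args) (concat-ωs k [ A ])
                   (concat-foldl-∧C (ωs k [ [ A ] ]) (map proj₁ args))
  reorder : (G ++ argOcc args) ++ (false , s') ∷ (true , s') ∷ [] ↭ occC false Γ ++ [ (true , s') ]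
  reorder = begin
    (G ++ argOcc args) ++ [ (false , s') ] ++ [ (true , s') ]
      ↭⟨ ++-assoc (G ++ argOcc args) [ (false , s') ] [ (true , s') ] ⟨
    ((G ++ argOcc args) ++ [ (false , s') ]) ++ [ (true , s') ]
      ↭⟨ ++⁺ʳ [ (true , s') ] (↭-Algebra.xy∙z≈yz∙x G (argOcc args) [ (false , s') ]) ⟩
    ((argOcc args ++ [ (false , s') ]) ++ G) ++ [ (true , s') ]
      ≡⟨ cong (λ o → (o ++ G) ++ [ (true , s') ]) (occT-arrows (map proj₂ args) s') ⟨
    occU false (A ∷ argTypes args) ++ [ (true , s') ]
      ↭⟨ ++⁺ʳ [ (true , s') ] (occU-↭ false (↭-sym concat-Γ)) ⟩
    occU false (concat Γ) ++ [ (true , s') ]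
      ≡⟨ cong (_++ [ (true , s') ]) (occC-concat false Γ) ⟨
    occC false Γ ++ [ (true , s') ] ∎
  finally-closed : FinallyClosed Γ (tv s')
  finally-closed with ∈-concat⁻′ Γ (∈-resp-↭ (↭-sym concat-Γ) (here refl))
  ... | u , A∈u , u∈Γ = u , ∈-++⁺ˡ (∈-LCtx A∈u u∈Γ) , A , A∈u , final-arrows (map proj₂ args) s'

betaNormal-lam : ∀ {M} → BetaNormal (lam M) → BetaNormal M
betaNormal-lam nf M N redex = nf M N (inLam redex)

betaNormal-appˡ : ∀ {M N} → BetaNormal (app M N) → BetaNormal M
betaNormal-appˡ nf M N redex = nf M N (inAppˡ redex)

betaNormal-appʳ : ∀ {M N} → BetaNormal (app M N) → BetaNormal N
betaNormal-appʳ nf M N redex = nf M N (inAppʳ redex)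

NotLam : Term → Set
NotLam (lam _) = ⊥
NotLam _       = ⊤

betaNormal-head : ∀ {M N} → BetaNormal (app M N) → NotLam M
betaNormal-head {var _}     nf = tt
betaNormal-head {app _ _}   nf = tt
betaNormal-head {lam M} {N} nf = nf M N here

InferredResult : ℕ → Ctx × Ty × ℕ → Set
InferredResult s (Γ , φ , s') = Inferred s s' Γ φ

InferredSpine : ℕ → Maybe (ℕ × List (Ctx × Ty)) × ℕ → Set
InferredSpine s (just (_ , args) , s') = InferredArgs s s' args
InferredSpine s (nothing , _)          = ⊥

mutual
  infer-inferred : ∀ N → BetaNormal N → ∀ s → InferredResult s (infer N s)
  infer-inferred (var k) _ s = inferred-app k (inferredArgs-[] s)
  infer-inferred (lam M) nf s with infer M s | infer-inferred M (betaNormal-lam nf) s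
  ... | u ∷ Γ , σ , s' | inf = inferred-lam inf
  ... | []    , σ , s' | inf = inferred-lam-ω inf
  infer-inferred (app M N) nf s with spine (app M N) s | spine-inferred (app M N) nf tt s
  ... | just (k , args) , s' | infs = inferred-app k infs

  spine-inferred : ∀ M → BetaNormal M → NotLam M → ∀ s → InferredSpine s (spine M s)
  spine-inferred (var k) _ _ s = inferredArgs-[] s
  spine-inferred (app M N) nf _ s
    with spine M s | spine-inferred M (betaNormal-appˡ nf) (betaNormal-head nf) s
  ... | just (k , args) , s₁ | infs with infer N s₁ | infer-inferred N (betaNormal-appʳ nf) s₁
  ...   | Γ , σ , s₂ | inf = inferredArgs-∷ʳ infs inf

lemma3p16 : (N : Term) → BetaNormal N → (s : ℕ) →
    let (Γ , φ , _) = infer N s in IsCType (⟨ Γ ⟩⇒ φ) × Complete Γ φ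
lemma3p16 N nf s = Inferred.complete (infer-inferred N nf s)
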